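{- There is an absolute constant $c>0$ such that for every $n\ge 1$ and $s\ge 1$ the following holds: if there is a monotone formula of size $s$ computing $\mathrm{MAJ}_{2n+1}$, then there is a formula of size at most $c\cdot s\cdot n^{\log_2 3}$ computing $\mathrm{MAJ}_{2n+1}$ and consisting only of $\mathrm{MAJ}_3$ gates and variables.
   Context: $\mathrm{MAJ}_{2n+1}\colon\{0,1\}^{2n+1}\to\{0,1\}$ outputs $1$ iff the input has at least $n+1$ ones; $\mathrm{MAJ}_3$ is the majority of three bits. A monotone formula is a rooted tree whose internal nodes are fan-in-2 $\wedge$ and $\vee$ gates and whose leaves are variables. A formula consisting only of $\mathrm{MAJ}_3$ gates and variables is a rooted tree whose internal nodes are $\mathrm{MAJ}_3$ gates with three children and whose leaves are variables (no constants, no negations). Size is the number of nodes. -}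

module Defs where

open import Data.Nat using (ℕ; zero; suc; _+_; _*_; _^_; _≤_; _<_; _≤ᵇ_)
open import Data.Bool using (Bool; true; false; _∧_; _∨_; if_then_else_)
open import Data.Fin using (Fin)
import Data.Fin as F

countOnes : {m : ℕ} → (Fin m → Bool) → ℕ
countOnes {zero}  x = 0
countOnes {suc m} x = (if x F.zero then 1 else 0) + countOnes (λ i → x (F.suc i))

MAJ : (n : ℕ) → (Fin (suc (2 * n)) → Bool) → Bool
MAJ n x = suc n ≤ᵇ countOnes x

maj3 : Bool → Bool → Bool → Bool
maj3 a b c = (a ∧ b) ∨ (a ∧ c) ∨ (b ∧ c)

data MonFormula (m : ℕ) : Set where
  var : Fin m → MonFormula m
  and : MonFormula m → MonFormula m → MonFormula m
  or  : MonFormula m → MonFormula m → MonFormula m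

evalMon : {m : ℕ} → MonFormula m → (Fin m → Bool) → Bool
evalMon (var i)   x = x i
evalMon (and f g) x = evalMon f x ∧ evalMon g x
evalMon (or f g)  x = evalMon f x ∨ evalMon g x

sizeMon : {m : ℕ} → MonFormula m → ℕ
sizeMon (var i)   = 1
sizeMon (and f g) = suc (sizeMon f + sizeMon g)
sizeMon (or f g)  = suc (sizeMon f + sizeMon g)

data Maj3Formula (m : ℕ) : Set where
  var  : Fin m → Maj3Formula m
  maj  : Maj3Formula m → Maj3Formula m → Maj3Formula m → Maj3Formula m

evalMaj3 : {m : ℕ} → Maj3Formula m → (Fin m → Bool) → Bool
evalMaj3 (var i)     x = x i
evalMaj3 (maj f g h) x = maj3 (evalMaj3 f x) (evalMaj3 g x) (evalMaj3 h x)

sizeMaj3 : {m : ℕ} → Maj3Formula m → ℕ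
sizeMaj3 (var i)     = 1
sizeMaj3 (maj f g h) = suc (sizeMaj3 f + sizeMaj3 g + sizeMaj3 h)

-- t ≤ a · n^{log₂ 3}, stated without reals (for n ≥ 1):
-- since log₂ 3 is irrational and n^r is continuous/monotone in r,
-- t ≤ a · n^{log₂ 3}  iff  for every rational p/q > log₂ 3 (i.e. 3^q < 2^p, q ≥ 1),
-- t ≤ a · n^{p/q}, i.e. t^q ≤ a^q · n^p.
-- LeTimesPowLog23 t a n  means  t ≤ a · n^{log₂ 3}.
LeTimesPowLog23 : ℕ → ℕ → ℕ → Set
LeTimesPowLog23 t a n = (p q : ℕ) → 1 ≤ q → 3 ^ q < 2 ^ p → t ^ q ≤ (a ^ q) * (n ^ p)

-- Replacing every ∧-gate of f by maj3(·,·,x_u) and every ∨-gate by maj3(·,·,x_v) gives a maj3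
-- formula that agrees with f when x_u = 0 and x_v = 1, and with the dual of f, which is MAJ again,
-- when x_u = 1 and x_v = 0; by monotonicity it accepts every 1-input of MAJ with x_u ∨ x_v = 1.
-- Put these formulas, one for each pair (u, v), at the leaves of a complete ternary tree of maj3
-- gates of depth D, and compare with the same tree whose leaves are x_u ∨ x_v. A 1-input of MAJ
-- has at most n zeros, so x_u = x_v = 0 for a fraction p ≤ (n/(2n+1))² < 1/4 of the pairs, and
-- each level of maj3 gates turns a fraction p of rejecting trees into at most 3p², so fewer than
-- (3/4)^(2^D) of the trees of depth D reject it. Once 2^D ≥ 3(2n+1) this is below 2^-(2n+1), and a
-- union bound over all inputs leaves a tree accepting every 1-input; since maj3 formulas and MAJ
-- are self-dual, its formula computes MAJ. Its size is below 3^D · 2s, and D = ⌊log₂ n⌋ + 4 gives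
-- 3^D ≤ 81 · n^(log₂ 3).

{-# OPTIONS --safe #-}
module Submission where

open import Defs
open import Data.Bool as Bool using (Bool; true; false; not; _∧_; _∨_; if_then_else_; T; b≤b; f≤t)
open import Data.Bool.ListAction using (any)
import Data.Bool.Properties as Boolₚ
open import Data.Empty using (⊥-elim)
open import Data.Fin using (Fin; zero; suc)
open import Data.List using (List; []; _∷_; _++_; map; length; cartesianProduct; tabulate; allFin)
open import Data.List.Membership.Propositional using (_∈_)
open import Data.List.Membership.Propositional.Properties using (∈-map⁺; ∈-++⁺ˡ; ∈-++⁺ʳ)
open import Data.List.Properties using (length-map; length-++; length-tabulate)
open import Data.List.Relation.Unary.Any using (here; there)
open import Data.Nat
  using (ℕ; zero; suc; _+_; _*_; _^_; _∸_; _≤_; _<_; _<?_; z≤n; s≤s; s≤s⁻¹; _≤ᵇ_; NonZero; >-nonZero)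
open import Data.Nat.ListAction using (sum)
open import Data.Nat.Properties
open import Data.Nat.Tactic.RingSolver using (solve-∀)
open import Data.Product using (Σ; ∃; _×_; _,_; proj₁; proj₂)
open import Data.Unit using (tt)
import Data.Vec.Functional as Vector
open import Function using (_∘_; id)
open import Relation.Nullary using (yes; no)
open import Relation.Binary.PropositionalEquality

private
  variable
    A B : Set
    m n d : ℕ

∧-mono : ∀ {a a′ b b′} → a Bool.≤ a′ → b Bool.≤ b′ → a ∧ b Bool.≤ a′ ∧ b′
∧-mono             f≤t _ = Boolₚ.≤-minimum _
∧-mono {a = false} b≤b _ = b≤b
∧-mono {a = true}  b≤b q = q

∨-mono : ∀ {a a′ b b′} → a Bool.≤ a′ → b Bool.≤ b′ → a ∨ b Bool.≤ a′ ∨ b′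
∨-mono             f≤t _ = Boolₚ.≤-maximum _
∨-mono {a = false} b≤b q = q
∨-mono {a = true}  b≤b _ = b≤b

≤-true⇒true : ∀ {a b} → a Bool.≤ b → a ≡ true → b ≡ true
≤-true⇒true b≤b refl = refl

not-∨ : ∀ a b → not (a ∨ b) ≡ not a ∧ not b
not-∨ false _ = refl
not-∨ true  _ = refl

maj3-mono : ∀ {a a′ b b′ c c′} → a Bool.≤ a′ → b Bool.≤ b′ → c Bool.≤ c′ →
            maj3 a b c Bool.≤ maj3 a′ b′ c′
maj3-mono p q r = ∨-mono (∧-mono p q) (∨-mono (∧-mono p r) (∧-mono q r))

maj3-cong : ∀ {a a′ b b′ c c′} → a ≡ a′ → b ≡ b′ → c ≡ c′ → maj3 a b c ≡ maj3 a′ b′ c′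
maj3-cong refl refl refl = refl

maj3-dual : ∀ a b c → maj3 (not a) (not b) (not c) ≡ not (maj3 a b c)
maj3-dual false false _     = refl
maj3-dual false true  false = refl
maj3-dual false true  true  = refl
maj3-dual true  false false = refl
maj3-dual true  false true  = refl
maj3-dual true  true  _     = refl

maj3-false : ∀ a b → maj3 a b false ≡ a ∧ b
maj3-false false false = refl
maj3-false false true  = refl
maj3-false true  false = refl
maj3-false true  true  = refl

maj3-true : ∀ a b → maj3 a b true ≡ a ∨ b
maj3-true false false = refl
maj3-true false true  = refl
maj3-true true  false = refl
maj3-true true  true  = refl

-- The `true` factors make every disjunct a product predicate on triples (see count-triples).
not-maj3-cover : ∀ a b c → not (maj3 a b c) Bool.≤
  (not a ∧ not b ∧ true) ∨ (not a ∧ true ∧ not c) ∨ (true ∧ not b ∧ not c)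
not-maj3-cover false false false = b≤b
not-maj3-cover false false true  = b≤b
not-maj3-cover false true  false = b≤b
not-maj3-cover false true  true  = Boolₚ.≤-minimum _
not-maj3-cover true  false false = b≤b
not-maj3-cover true  false true  = Boolₚ.≤-minimum _
not-maj3-cover true  true  false = Boolₚ.≤-minimum _
not-maj3-cover true  true  true  = Boolₚ.≤-minimum _

-- Self-duality

-- Stated for every y ≗ not ∘ x because, without function extensionality, not ∘ (not ∘ x) is not x.
SelfDual : ((Fin m → Bool) → Bool) → Set
SelfDual F = ∀ {x y} → y ≗ not ∘ x → F y ≡ not (F x)

selfDual-agree : {F G : (Fin m → Bool) → Bool} → SelfDual F → SelfDual G →
                 (∀ x → F x ≡ true → G x ≡ true) → ∀ x → G x ≡ F x
selfDual-agree {F = F} {G} F-dual G-dual F⇒G x with F x in Fx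
... | true  = F⇒G x Fx
... | false = begin
  G x               ≡⟨ G-dual (λ i → sym (Boolₚ.not-involutive (x i))) ⟩
  not (G (not ∘ x)) ≡⟨ cong not (F⇒G (not ∘ x) F¬x) ⟩
  false             ∎
  where
  open ≡-Reasoning
  F¬x : F (not ∘ x) ≡ true
  F¬x = trans (F-dual (λ _ → refl)) (cong not Fx)

evalMaj3-selfDual : (g : Maj3Formula m) → SelfDual (evalMaj3 g)
evalMaj3-selfDual (var i)     y≗¬x = y≗¬x i
evalMaj3-selfDual (maj f g h) {x} y≗¬x =
  trans (maj3-cong (evalMaj3-selfDual f y≗¬x) (evalMaj3-selfDual g y≗¬x)
                   (evalMaj3-selfDual h y≗¬x))
        (maj3-dual (evalMaj3 f x) (evalMaj3 g x) (evalMaj3 h x))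

countOnes-cong : {x y : Fin m → Bool} → x ≗ y → countOnes x ≡ countOnes y
countOnes-cong {zero}  _   = refl
countOnes-cong {suc m} x≗y =
  cong₂ _+_ (cong (λ b → if b then 1 else 0) (x≗y zero)) (countOnes-cong (x≗y ∘ suc))

countOnes-complement : {x y : Fin m → Bool} → y ≗ not ∘ x → countOnes y + countOnes x ≡ m
countOnes-complement {zero}          _    = refl
countOnes-complement {suc m} {x} {y} y≗¬x rewrite y≗¬x zero with x zero
... | true  = trans (+-suc _ _) (cong suc (countOnes-complement (y≗¬x ∘ suc)))
... | false = cong suc (countOnes-complement (y≗¬x ∘ suc))

MAJ-true⇒> : {x : Fin (suc (2 * n)) → Bool} → MAJ n x ≡ true → n < countOnes x
MAJ-true⇒> {n} {x} Mx = ≤ᵇ⇒≤ (suc n) (countOnes x) (subst T (sym Mx) tt)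

MAJ-false⇒≤ : {x : Fin (suc (2 * n)) → Bool} → MAJ n x ≡ false → countOnes x ≤ n
MAJ-false⇒≤ Mx = s≤s⁻¹ (≮⇒≥ λ n<x → subst T Mx (≤⇒≤ᵇ n<x))

odd-split-≤ : ∀ {a b} → a + b ≡ suc (2 * n) → n < a → b ≤ n
odd-split-≤ {n} {a} {b} a+b n<a = +-cancelˡ-≤ (suc n) b n (begin
  suc n + b   ≤⟨ +-monoˡ-≤ b n<a ⟩
  a + b       ≡⟨ a+b ⟩
  suc (2 * n) ≡⟨ cong suc (cong (n +_) (+-identityʳ n)) ⟩
  suc n + n   ∎)
  where open ≤-Reasoning

odd-split-< : ∀ {a b} → a + b ≡ suc (2 * n) → b ≤ n → n < a
odd-split-< {n} {a} {b} a+b b≤n = +-cancelʳ-≤ n (suc n) a (begin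
  suc n + n   ≡⟨ cong suc (cong (n +_) (sym (+-identityʳ n))) ⟩
  suc (2 * n) ≡⟨ sym a+b ⟩
  a + b       ≤⟨ +-monoʳ-≤ a b≤n ⟩
  a + n       ∎)
  where open ≤-Reasoning

MAJ-selfDual : SelfDual (MAJ n)
MAJ-selfDual {n} {x} {y} y≗¬x with MAJ n x in Mx | MAJ n y in My
... | true  | false = refl
... | false | true  = refl
... | true  | true  = ⊥-elim (<⇒≱ (MAJ-true⇒> {n} {x} Mx)
                                 (odd-split-≤ (countOnes-complement y≗¬x) (MAJ-true⇒> {n} {y} My)))
... | false | false = ⊥-elim (<⇒≱ (odd-split-< (countOnes-complement y≗¬x) (MAJ-false⇒≤ {n} {x} Mx))
                                 (MAJ-false⇒≤ {n} {y} My))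

MAJ-cong : {x y : Fin (suc (2 * n)) → Bool} → x ≗ y → MAJ n x ≡ MAJ n y
MAJ-cong {n} x≗y = cong (suc n ≤ᵇ_) (countOnes-cong x≗y)

zeros≤n : {x : Fin (suc (2 * n)) → Bool} → MAJ n x ≡ true → countOnes (not ∘ x) ≤ n
zeros≤n {n} {x} Mx =
  MAJ-false⇒≤ {n} {not ∘ x} (trans (MAJ-selfDual {n} {x} (λ _ → refl)) (cong not Mx))

-- Monotone formulas as maj3 formulas

evalMedian : Bool → Bool → MonFormula m → (Fin m → Bool) → Bool
evalMedian z o (var i)   x = x i
evalMedian z o (and f g) x = maj3 (evalMedian z o f x) (evalMedian z o g x) z
evalMedian z o (or f g)  x = maj3 (evalMedian z o f x) (evalMedian z o g x) o

evalMedian-false-true : ∀ (f : MonFormula m) x → evalMedian false true f x ≡ evalMon f x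
evalMedian-false-true (var i)   x = refl
evalMedian-false-true (and f g) x =
  trans (maj3-false (evalMedian false true f x) (evalMedian false true g x))
        (cong₂ _∧_ (evalMedian-false-true f x) (evalMedian-false-true g x))
evalMedian-false-true (or f g)  x =
  trans (maj3-true (evalMedian false true f x) (evalMedian false true g x))
        (cong₂ _∨_ (evalMedian-false-true f x) (evalMedian-false-true g x))

evalMedian-dual : ∀ z o (f : MonFormula m) {x y} → y ≗ not ∘ x →
                  evalMedian (not z) (not o) f y ≡ not (evalMedian z o f x)
evalMedian-dual z o (var i)   y≗¬x = y≗¬x i
evalMedian-dual z o (and f g) {x} y≗¬x =
  trans (maj3-cong (evalMedian-dual z o f y≗¬x) (evalMedian-dual z o g y≗¬x) refl)
        (maj3-dual (evalMedian z o f x) (evalMedian z o g x) z)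
evalMedian-dual z o (or f g)  {x} y≗¬x =
  trans (maj3-cong (evalMedian-dual z o f y≗¬x) (evalMedian-dual z o g y≗¬x) refl)
        (maj3-dual (evalMedian z o f x) (evalMedian z o g x) o)

evalMedian-mono : ∀ {z z′ o o′} → z Bool.≤ z′ → o Bool.≤ o′ →
                  (f : MonFormula m) (x : Fin m → Bool) → evalMedian z o f x Bool.≤ evalMedian z′ o′ f x
evalMedian-mono z≤z′ o≤o′ (var i)   x = b≤b
evalMedian-mono z≤z′ o≤o′ (and f g) x =
  maj3-mono (evalMedian-mono z≤z′ o≤o′ f x) (evalMedian-mono z≤z′ o≤o′ g x) z≤z′
evalMedian-mono z≤z′ o≤o′ (or f g)  x =
  maj3-mono (evalMedian-mono z≤z′ o≤o′ f x) (evalMedian-mono z≤z′ o≤o′ g x) o≤o′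

-- evalMedian true false f computes the dual of f.
evalMedian-true-false : {F : (Fin m → Bool) → Bool} (f : MonFormula m) →
                        (∀ x → evalMon f x ≡ F x) → SelfDual F → ∀ x → evalMedian true false f x ≡ F x
evalMedian-true-false {F = F} f f≗F F-dual x = begin
  evalMedian true false f x
    ≡⟨ evalMedian-dual false true f (λ i → sym (Boolₚ.not-involutive (x i))) ⟩
  not (evalMedian false true f (not ∘ x))
    ≡⟨ cong not (trans (evalMedian-false-true f (not ∘ x)) (f≗F (not ∘ x))) ⟩
  not (F (not ∘ x))
    ≡⟨ cong not (F-dual (λ _ → refl)) ⟩
  not (not (F x))
    ≡⟨ Boolₚ.not-involutive (F x) ⟩
  F x
    ∎
  where open ≡-Reasoning

toMaj3 : Fin m → Fin m → MonFormula m → Maj3Formula m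
toMaj3 u v (var i)   = var i
toMaj3 u v (and f g) = maj (toMaj3 u v f) (toMaj3 u v g) (var u)
toMaj3 u v (or f g)  = maj (toMaj3 u v f) (toMaj3 u v g) (var v)

evalMaj3-toMaj3 : ∀ (u v : Fin m) f x → evalMaj3 (toMaj3 u v f) x ≡ evalMedian (x u) (x v) f x
evalMaj3-toMaj3 u v (var i)   x = refl
evalMaj3-toMaj3 u v (and f g) x = maj3-cong (evalMaj3-toMaj3 u v f x) (evalMaj3-toMaj3 u v g x) refl
evalMaj3-toMaj3 u v (or f g)  x = maj3-cong (evalMaj3-toMaj3 u v f x) (evalMaj3-toMaj3 u v g x) refl

gate-size : ∀ {a b p q} → p < 2 * a → q < 2 * b → suc (p + q + 1) < 2 * suc (a + b)
gate-size {a} {b} {p} {q} p<2a q<2b = begin-strict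
  suc (p + q + 1)           ≡⟨ lhs p q ⟩
  suc p + suc q             ≤⟨ +-mono-≤ p<2a q<2b ⟩
  2 * a + 2 * b             <⟨ n<1+n _ ⟩
  suc (2 * a + 2 * b)       ≤⟨ n≤1+n _ ⟩
  suc (suc (2 * a + 2 * b)) ≡⟨ rhs a b ⟩
  2 * suc (a + b)           ∎
  where
  open ≤-Reasoning
  lhs : ∀ p q → suc (p + q + 1) ≡ suc p + suc q
  lhs = solve-∀
  rhs : ∀ a b → suc (suc (2 * a + 2 * b)) ≡ 2 * suc (a + b)
  rhs = solve-∀

sizeMaj3-toMaj3 : ∀ (u v : Fin m) f → sizeMaj3 (toMaj3 u v f) < 2 * sizeMon f
sizeMaj3-toMaj3 u v (var i)   = s≤s (s≤s z≤n)
sizeMaj3-toMaj3 u v (and f g) =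
  gate-size {sizeMon f} {sizeMon g} (sizeMaj3-toMaj3 u v f) (sizeMaj3-toMaj3 u v g)
sizeMaj3-toMaj3 u v (or f g)  =
  gate-size {sizeMon f} {sizeMon g} (sizeMaj3-toMaj3 u v f) (sizeMaj3-toMaj3 u v g)

toMaj3-covers : {F : (Fin m → Bool) → Bool} (f : MonFormula m) → (∀ x → evalMon f x ≡ F x) →
                SelfDual F → ∀ {x} u v → F x ≡ true → x u ∨ x v Bool.≤ evalMaj3 (toMaj3 u v f) x
toMaj3-covers f f≗F F-dual {x} u v Fx =
  subst (x u ∨ x v Bool.≤_) (sym (evalMaj3-toMaj3 u v f x)) (covers (x u) (x v))
  where
  covers : ∀ z o → z ∨ o Bool.≤ evalMedian z o f x
  covers false false = Boolₚ.≤-minimum _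
  covers false true  = Boolₚ.≤-reflexive (sym (trans (evalMedian-false-true f x) (trans (f≗F x) Fx)))
  covers true  false = Boolₚ.≤-reflexive (sym (trans (evalMedian-true-false f f≗F F-dual x) Fx))
  covers true  true  = Boolₚ.≤-trans (covers false true) (evalMedian-mono f≤t b≤b f x)

-- Ternary majority trees

data Tree (A : Set) : ℕ → Set where
  leaf : A → Tree A zero
  node : Tree A d → Tree A d → Tree A d → Tree A (suc d)

evalTree : (A → Bool) → Tree A d → Bool
evalTree v (leaf a)     = v a
evalTree v (node r s t) = maj3 (evalTree v r) (evalTree v s) (evalTree v t)

evalTree-mono : {v w : A → Bool} → (∀ a → v a Bool.≤ w a) →
                (t : Tree A d) → evalTree v t Bool.≤ evalTree w t
evalTree-mono v≤w (leaf a)     = v≤w a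
evalTree-mono v≤w (node r s t) =
  maj3-mono (evalTree-mono v≤w r) (evalTree-mono v≤w s) (evalTree-mono v≤w t)

evalTree-cong : {v w : A → Bool} → v ≗ w → (t : Tree A d) → evalTree v t ≡ evalTree w t
evalTree-cong v≗w (leaf a)     = v≗w a
evalTree-cong v≗w (node r s t) =
  maj3-cong (evalTree-cong v≗w r) (evalTree-cong v≗w s) (evalTree-cong v≗w t)

graft : (A → Maj3Formula m) → Tree A d → Maj3Formula m
graft φ (leaf a)     = φ a
graft φ (node r s t) = maj (graft φ r) (graft φ s) (graft φ t)

evalMaj3-graft : (φ : A → Maj3Formula m) (t : Tree A d) (x : Fin m → Bool) →
                 evalMaj3 (graft φ t) x ≡ evalTree (λ a → evalMaj3 (φ a) x) t
evalMaj3-graft φ (leaf a)     x = refl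
evalMaj3-graft φ (node r s t) x =
  maj3-cong (evalMaj3-graft φ r x) (evalMaj3-graft φ s x) (evalMaj3-graft φ t x)

sizeMaj3-graft : ∀ {k} (φ : A → Maj3Formula m) → (∀ a → sizeMaj3 (φ a) < k) →
                 (t : Tree A d) → sizeMaj3 (graft φ t) < 3 ^ d * k
sizeMaj3-graft {k = k} φ φ<k (leaf a) = ≤-trans (φ<k a) (≤-reflexive (sym (*-identityˡ k)))
sizeMaj3-graft {d = suc d} {k = k} φ φ<k (node r s t) = begin-strict
  suc (sizeMaj3 (graft φ r) + sizeMaj3 (graft φ s)) + sizeMaj3 (graft φ t)
    <⟨ +-mono-≤-< (+-mono-< (size r) (size s)) (size t) ⟩
  3 ^ d * k + 3 ^ d * k + 3 ^ d * k
    ≡⟨ thrice (3 ^ d) k ⟩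
  3 ^ suc d * k
    ∎
  where
  open ≤-Reasoning
  size : (t : Tree _ d) → sizeMaj3 (graft φ t) < 3 ^ d * k
  size = sizeMaj3-graft φ φ<k
  thrice : ∀ x k → x * k + x * k + x * k ≡ 3 * x * k
  thrice = solve-∀

count : (A → Bool) → List A → ℕ
count p []       = 0
count p (a ∷ as) = (if p a then 1 else 0) + count p as

count-true : (as : List A) → count (λ _ → true) as ≡ length as
count-true []       = refl
count-true (_ ∷ as) = cong suc (count-true as)

count-false : (as : List A) → count (λ _ → false) as ≡ 0
count-false []       = refl
count-false (_ ∷ as) = count-false as

count-++ : (p : A → Bool) (as bs : List A) → count p (as ++ bs) ≡ count p as + count p bs
count-++ p []       bs = refl
count-++ p (a ∷ as) bs =
  trans (cong ((if p a then 1 else 0) +_) (count-++ p as bs)) (sym (+-assoc (if p a then 1 else 0) _ _))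

count-map : (p : B → Bool) (f : A → B) (as : List A) → count p (map f as) ≡ count (p ∘ f) as
count-map p f []       = refl
count-map p f (a ∷ as) = cong ((if p (f a) then 1 else 0) +_) (count-map p f as)

count-mono : {p q : A → Bool} → (∀ a → p a Bool.≤ q a) →
             (as : List A) → count p as ≤ count q as
count-mono p≤q []       = z≤n
count-mono {p = p} {q} p≤q (a ∷ as) with p a | q a | p≤q a
... | false | true | f≤t = m≤n⇒m≤1+n (count-mono p≤q as)
... | b     | .b   | b≤b = +-monoʳ-≤ (if b then 1 else 0) (count-mono p≤q as)

count-∨ : (p q : A → Bool) (as : List A) →
          count (λ a → p a ∨ q a) as ≤ count p as + count q as
count-∨ p q []       = z≤n
count-∨ p q (a ∷ as) with p a | q a
... | false | false = count-∨ p q as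
... | false | true  = ≤-trans (s≤s (count-∨ p q as)) (≤-reflexive (sym (+-suc _ _)))
... | true  | false = s≤s (count-∨ p q as)
... | true  | true  =
  s≤s (≤-trans (count-∨ p q as) (≤-trans (n≤1+n _) (≤-reflexive (sym (+-suc _ _)))))

count-const-∧ : (c : Bool) (q : A → Bool) (as : List A) →
                count (λ a → c ∧ q a) as ≡ (if c then 1 else 0) * count q as
count-const-∧ false q as = count-false as
count-const-∧ true  q as = sym (+-identityʳ (count q as))

count-∧-bound : ∀ {k r} (c : Bool) {q : A → Bool} (as : List A) →
                (c ≡ true → k * count q as ≤ r) → k * count (λ a → c ∧ q a) as ≤ r
count-∧-bound {k = k} false as _     =
  ≤-trans (≤-reflexive (trans (cong (k *_) (count-false as)) (*-zeroʳ k))) z≤n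
count-∧-bound         true  as bound = bound refl

count-× : (p : A → Bool) (q : B → Bool) (as : List A) (bs : List B) →
          count (λ ab → p (proj₁ ab) ∧ q (proj₂ ab)) (cartesianProduct as bs)
            ≡ count p as * count q bs
count-× p q []       bs = refl
count-× {A = A} {B = B} p q (a ∷ as) bs = begin
  count r (map (a ,_) bs ++ cartesianProduct as bs)
    ≡⟨ count-++ r (map (a ,_) bs) (cartesianProduct as bs) ⟩
  count r (map (a ,_) bs) + count r (cartesianProduct as bs)
    ≡⟨ cong₂ _+_ (count-map r (a ,_) bs) (count-× p q as bs) ⟩
  count (λ b → p a ∧ q b) bs + count p as * count q bs
    ≡⟨ cong (_+ count p as * count q bs) (count-const-∧ (p a) q bs) ⟩
  (if p a then 1 else 0) * count q bs + count p as * count q bs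
    ≡⟨ *-distribʳ-+ (count q bs) (if p a then 1 else 0) (count p as) ⟨
  count p (a ∷ as) * count q bs
    ∎
  where
  open ≡-Reasoning
  r : A × B → Bool
  r ab = p (proj₁ ab) ∧ q (proj₂ ab)

length-cartesianProduct : (as : List A) (bs : List B) →
                          length (cartesianProduct as bs) ≡ length as * length bs
length-cartesianProduct as bs = begin
  length (cartesianProduct as bs)
    ≡⟨ count-true (cartesianProduct as bs) ⟨
  count (λ _ → true) (cartesianProduct as bs)
    ≡⟨ count-× (λ _ → true) (λ _ → true) as bs ⟩
  count (λ _ → true) as * count (λ _ → true) bs
    ≡⟨ cong₂ _*_ (count-true as) (count-true bs) ⟩
  length as * length bs
    ∎
  where open ≡-Reasoning

count-tabulate : (p : A → Bool) (g : Fin m → A) → count p (tabulate g) ≡ countOnes (p ∘ g)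
count-tabulate {m = zero}  p g = refl
count-tabulate {m = suc m} p g = cong ((if p (g zero) then 1 else 0) +_) (count-tabulate p (g ∘ suc))

count<length⇒∃false : {p : A → Bool} (as : List A) →
                      count p as < length as → ∃ λ a → p a ≡ false
count<length⇒∃false {p = p} (a ∷ as) lt with p a in pa
... | false = a , pa
... | true  = count<length⇒∃false as (s≤s⁻¹ lt)

any≡false⇒false : {p : A → Bool} {as : List A} {a : A} →
                  any p as ≡ false → a ∈ as → p a ≡ false
any≡false⇒false {p = p} {a ∷ _} none (here refl) = Boolₚ.∨-conicalˡ (p a) _ none
any≡false⇒false {p = p} {b ∷ _} none (there a∈) =
  any≡false⇒false (Boolₚ.∨-conicalʳ (p b) _ none) a∈

union-bound : (p : B → A → Bool) (bs : List B) (as : List A) →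
              count (λ a → any (λ b → p b a) bs) as ≤ sum (map (λ b → count (p b) as) bs)
union-bound p []       as = ≤-reflexive (count-false as)
union-bound p (b ∷ bs) as =
  ≤-trans (count-∨ (p b) (λ a → any (λ b → p b a) bs) as)
          (+-monoʳ-≤ (count (p b) as) (union-bound p bs as))

∃-passing-all : (p : B → A → Bool) (bs : List B) (as : List A) →
                sum (map (λ b → count (p b) as) bs) < length as →
                ∃ λ a → ∀ {b} → b ∈ bs → p b a ≡ false
∃-passing-all p bs as few with count<length⇒∃false as (≤-<-trans (union-bound p bs as) few)
... | a , none = a , any≡false⇒false none

sum-map-≤ : ∀ {k c} (g : B → ℕ) → (∀ b → k * g b ≤ c) →
            (bs : List B) → k * sum (map g bs) ≤ length bs * c
sum-map-≤ {k = k} g kg≤c []       = ≤-reflexive (*-zeroʳ k)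
sum-map-≤ {k = k} g kg≤c (b ∷ bs) = begin
  k * (g b + sum (map g bs))       ≡⟨ *-distribˡ-+ k (g b) (sum (map g bs)) ⟩
  k * g b + k * sum (map g bs)     ≤⟨ +-mono-≤ (kg≤c b) (sum-map-≤ {k = k} g kg≤c bs) ⟩
  _                                ∎
  where open ≤-Reasoning

inputs : (m : ℕ) → List (Fin m → Bool)
inputs zero    = Vector.[] ∷ []
inputs (suc m) = map (true Vector.∷_) (inputs m) ++ map (false Vector.∷_) (inputs m)

length-inputs : (m : ℕ) → length (inputs m) ≡ 2 ^ m
length-inputs zero    = refl
length-inputs (suc m) = begin
  length (map (true Vector.∷_) (inputs m) ++ map (false Vector.∷_) (inputs m))
    ≡⟨ length-++ (map (true Vector.∷_) (inputs m)) ⟩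
  length (map (true Vector.∷_) (inputs m)) + length (map (false Vector.∷_) (inputs m))
    ≡⟨ cong₂ _+_ (length-map (true Vector.∷_) (inputs m))
                 (length-map (false Vector.∷_) (inputs m)) ⟩
  length (inputs m) + length (inputs m)
    ≡⟨ cong₂ _+_ (length-inputs m) (trans (length-inputs m) (sym (+-identityʳ (2 ^ m)))) ⟩
  2 ^ suc m
    ∎
  where open ≡-Reasoning

∷-∈-inputs : ∀ b {x} → x ∈ inputs m → b Vector.∷ x ∈ inputs (suc m)
∷-∈-inputs true  x∈ = ∈-++⁺ˡ (∈-map⁺ (true Vector.∷_) x∈)
∷-∈-inputs false x∈ = ∈-++⁺ʳ _ (∈-map⁺ (false Vector.∷_) x∈)

inputs-complete : (x : Fin m → Bool) → ∃ λ y → y ∈ inputs m × y ≗ x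
inputs-complete {zero}  x = Vector.[] , here refl , λ ()
inputs-complete {suc m} x with inputs-complete (Vector.tail x)
... | y , y∈ , y≗tail =
  x zero Vector.∷ y , ∷-∈-inputs (x zero) y∈ , λ { zero → refl ; (suc i) → y≗tail i }

-- Amplification

node³ : Tree A d × Tree A d × Tree A d → Tree A (suc d)
node³ (r , s , t) = node r s t

triples : List A → List (A × A × A)
triples as = cartesianProduct as (cartesianProduct as as)

count-triples : (p q w : A → Bool) (as : List A) →
  count (λ rst → p (proj₁ rst) ∧ q (proj₁ (proj₂ rst)) ∧ w (proj₂ (proj₂ rst))) (triples as)
    ≡ count p as * (count q as * count w as)
count-triples p q w as =
  trans (count-× p (λ st → q (proj₁ st) ∧ w (proj₂ st)) as (cartesianProduct as as))
        (cong (count p as *_) (count-× q w as as))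

trees : List A → (d : ℕ) → List (Tree A d)
trees as zero    = map leaf as
trees as (suc d) = map node³ (triples (trees as d))

length-trees-suc : (as : List A) (d : ℕ) →
  length (trees as (suc d)) ≡ length (trees as d) * (length (trees as d) * length (trees as d))
length-trees-suc as d = begin
  length (map node³ (triples ts))
    ≡⟨ length-map node³ (triples ts) ⟩
  length (triples ts)
    ≡⟨ length-cartesianProduct ts (cartesianProduct ts ts) ⟩
  length ts * length (cartesianProduct ts ts)
    ≡⟨ cong (length ts *_) (length-cartesianProduct ts ts) ⟩
  length ts * (length ts * length ts)
    ∎
  where
  open ≡-Reasoning
  ts : List (Tree _ d)
  ts = trees as d

length-trees-pos : (as : List A) → 0 < length as → (d : ℕ) → 0 < length (trees as d)
length-trees-pos as as≢[] zero    = ≤-trans as≢[] (≤-reflexive (sym (length-map leaf as)))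
length-trees-pos as as≢[] (suc d) =
  ≤-trans (*-mono-≤ N>0 (*-mono-≤ N>0 N>0)) (≤-reflexive (sym (length-trees-suc as d)))
  where
  N>0 : 0 < length (trees as d)
  N>0 = length-trees-pos as as≢[] d

rejections : List A → (A → Bool) → ℕ → ℕ
rejections as v d = count (not ∘ evalTree v) (trees as d)

rejections-suc : (as : List A) (v : A → Bool) (d : ℕ) →
  let R = rejections as v d ; N = length (trees as d) in
  rejections as v (suc d) ≤ R * (R * N) + (R * (N * R) + N * (R * R))
rejections-suc {A = A} as v d = begin
  count rejects (map node³ (triples ts))
    ≡⟨ count-map rejects node³ (triples ts) ⟩
  count (rejects ∘ node³) (triples ts)
    ≤⟨ count-mono (λ rst → not-maj3-cover (ev (proj₁ rst)) (ev (proj₁ (proj₂ rst))) (ev (proj₂ (proj₂ rst))))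
                  (triples ts) ⟩
  count (λ rst → P₁ rst ∨ P₂ rst ∨ P₃ rst) (triples ts)
    ≤⟨ count-∨ P₁ (λ rst → P₂ rst ∨ P₃ rst) (triples ts) ⟩
  count P₁ (triples ts) + count (λ rst → P₂ rst ∨ P₃ rst) (triples ts)
    ≤⟨ +-monoʳ-≤ (count P₁ (triples ts)) (count-∨ P₂ P₃ (triples ts)) ⟩
  count P₁ (triples ts) + (count P₂ (triples ts) + count P₃ (triples ts))
    ≡⟨ cong₂ _+_ (count-triples rejects rejects always ts)
                 (cong₂ _+_ (count-triples rejects always rejects ts)
                            (count-triples always rejects rejects ts)) ⟩
  R * (R * N′) + (R * (N′ * R) + N′ * (R * R))
    ≡⟨ cong (λ N → R * (R * N) + (R * (N * R) + N * (R * R))) (count-true ts) ⟩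
  R * (R * N) + (R * (N * R) + N * (R * R))
    ∎
  where
  open ≤-Reasoning
  ts : List (Tree A d)
  ts = trees as d
  ev : {e : ℕ} → Tree A e → Bool
  ev = evalTree v
  rejects : {e : ℕ} → Tree A e → Bool
  rejects = not ∘ ev
  always : Tree A d → Bool
  always _ = true
  P₁ P₂ P₃ : Tree A d × Tree A d × Tree A d → Bool
  P₁ rst = rejects (proj₁ rst) ∧ rejects (proj₁ (proj₂ rst)) ∧ true
  P₂ rst = rejects (proj₁ rst) ∧ true ∧ rejects (proj₂ (proj₂ rst))
  P₃ rst = true ∧ rejects (proj₁ (proj₂ rst)) ∧ rejects (proj₂ (proj₂ rst))
  R N N′ : ℕ
  R = count rejects ts
  N = length ts
  N′ = count always ts

squaring-step : ∀ {a b r r′ N} → a * 3 * r ≤ b * N →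
                r′ ≤ r * (r * N) + (r * (N * r) + N * (r * r)) → a * a * 3 * r′ ≤ b * b * (N * (N * N))
squaring-step {a} {b} {r} {r′} {N} ar≤bN r′≤ = begin
  a * a * 3 * r′                                          ≤⟨ *-monoʳ-≤ (a * a * 3) r′≤ ⟩
  a * a * 3 * (r * (r * N) + (r * (N * r) + N * (r * r))) ≡⟨ square-left a r N ⟩
  a * 3 * r * (a * 3 * r) * N                             ≤⟨ *-monoˡ-≤ N (*-mono-≤ ar≤bN ar≤bN) ⟩
  b * N * (b * N) * N                                     ≡⟨ square-right b N ⟩
  b * b * (N * (N * N))                                   ∎
  where
  open ≤-Reasoning
  square-left : ∀ a r N →
    a * a * 3 * (r * (r * N) + (r * (N * r) + N * (r * r))) ≡ a * 3 * r * (a * 3 * r) * N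
  square-left = solve-∀
  square-right : ∀ b N → b * N * (b * N) * N ≡ b * b * (N * (N * N))
  square-right = solve-∀

^-double : ∀ x d → x ^ 2 ^ suc d ≡ x ^ 2 ^ d * x ^ 2 ^ d
^-double x d =
  trans (cong (λ e → x ^ (2 ^ d + e)) (+-identityʳ (2 ^ d))) (^-distribˡ-+-* x (2 ^ d) (2 ^ d))

-- With p_d the fraction of rejecting trees of depth d, p_{d+1} ≤ 3 p_d², so 3 p_d ≤ (3 p_0)^(2^d).
amplification : ∀ {a b} (as : List A) (v : A → Bool) →
  a * 3 * rejections as v 0 ≤ b * length (trees as 0) →
  ∀ d → a ^ 2 ^ d * 3 * rejections as v d ≤ b ^ 2 ^ d * length (trees as d)
amplification {a = a} {b} as v base zero =
  subst₂ (λ a′ b′ → a′ * 3 * rejections as v 0 ≤ b′ * length (trees as 0))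
         (sym (^-identityʳ a)) (sym (^-identityʳ b)) base
amplification {a = a} {b} as v base (suc d) = begin
  a ^ 2 ^ suc d * 3 * rejections as v (suc d)
    ≡⟨ cong (λ e → e * 3 * rejections as v (suc d)) (^-double a d) ⟩
  a ^ 2 ^ d * a ^ 2 ^ d * 3 * rejections as v (suc d)
    ≤⟨ squaring-step {a ^ 2 ^ d} {b ^ 2 ^ d} (amplification {a = a} {b} as v base d) (rejections-suc as v d) ⟩
  b ^ 2 ^ d * b ^ 2 ^ d * (N * (N * N))
    ≡⟨ cong₂ _*_ (^-double b d) (length-trees-suc as d) ⟨
  b ^ 2 ^ suc d * length (trees as (suc d))
    ∎
  where
  open ≤-Reasoning
  N : ℕ
  N = length (trees as d)

2^m*3^[3m+r]≤4^[3m+r] : ∀ m r → 2 ^ m * 3 ^ (m * 3 + r) ≤ 4 ^ (m * 3 + r)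
2^m*3^[3m+r]≤4^[3m+r] zero    r = ≤-trans (≤-reflexive (*-identityˡ (3 ^ r))) (^-monoˡ-≤ r (n≤1+n 3))
2^m*3^[3m+r]≤4^[3m+r] (suc m) r = begin
  2 ^ suc m * 3 ^ (3 + e) ≡⟨ split (2 ^ m) (3 ^ e) ⟩
  54 * (2 ^ m * 3 ^ e)    ≤⟨ *-mono-≤ (m≤m+n 54 10) (2^m*3^[3m+r]≤4^[3m+r] m r) ⟩
  64 * 4 ^ e              ≡⟨ join (4 ^ e) ⟩
  4 ^ (3 + e)             ∎
  where
  open ≤-Reasoning
  e : ℕ
  e = m * 3 + r
  split : ∀ x y → 2 * x * (3 * (3 * (3 * y))) ≡ 54 * (x * y)
  split = solve-∀
  join : ∀ z → 64 * z ≡ 4 * (4 * (4 * z))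
  join = solve-∀

2^m*3^E≤4^E : ∀ {m E} → 3 * m ≤ E → 2 ^ m * 3 ^ E ≤ 4 ^ E
2^m*3^E≤4^E {m} {E} 3m≤E =
  subst (λ e → 2 ^ m * 3 ^ e ≤ 4 ^ e) (m+[n∸m]≡n (subst (_≤ E) (*-comm 3 m) 3m≤E))
        (2^m*3^[3m+r]≤4^[3m+r] m (E ∸ m * 3))

2^m*3^E<4^E*3 : ∀ {m E} → 3 * m ≤ E → 2 ^ m * 3 ^ E < 4 ^ E * 3
2^m*3^E<4^E*3 {m} {E} 3m≤E =
  ≤-<-trans (2^m*3^E≤4^E {m} 3m≤E) (m<m*n (4 ^ E) 3 ⦃ m^n≢0 4 E ⦄ (s≤s (s≤s z≤n)))

2^K≤n<2^[1+K] : ∀ {n} → 1 ≤ n → ∃ λ K → 2 ^ K ≤ n × n < 2 ^ suc K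
2^K≤n<2^[1+K] {suc zero}    _ = 0 , ≤-refl , s≤s (s≤s z≤n)
2^K≤n<2^[1+K] {suc (suc n)} _ with 2^K≤n<2^[1+K] {suc n} (s≤s z≤n)
... | K , lo , hi with suc (suc n) <? 2 ^ suc K
...   | yes hi′ = K , m≤n⇒m≤1+n lo , hi′
...   | no ¬hi′ = suc K , ≮⇒≥ ¬hi′ , ≤-<-trans hi 2^[1+K]<2^[2+K]
  where
  2^[1+K]<2^[2+K] : 2 ^ suc K < 2 ^ suc (suc K)
  2^[1+K]<2^[2+K] = <-≤-trans (m<m*n (2 ^ suc K) 2 ⦃ m^n≢0 2 (suc K) ⦄ (s≤s (s≤s z≤n)))
                              (≤-reflexive (*-comm (2 ^ suc K) 2))

3[1+2n]≤2^[4+K] : ∀ {n K} → n < 2 ^ suc K → 3 * suc (2 * n) ≤ 2 ^ (4 + K)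
3[1+2n]≤2^[4+K] {n} {K} n<2^[1+K] = begin
  3 * suc (2 * n)                 ≤⟨ m≤m+n (3 * suc (2 * n)) 3 ⟩
  3 * suc (2 * n) + 3             ≡⟨ six n ⟩
  6 * suc n                       ≤⟨ *-monoʳ-≤ 6 n<2^[1+K] ⟩
  6 * (2 * 2 ^ K)                 ≤⟨ m≤m+n (6 * (2 * 2 ^ K)) (4 * 2 ^ K) ⟩
  6 * (2 * 2 ^ K) + 4 * 2 ^ K     ≡⟨ sixteen (2 ^ K) ⟩
  2 * (2 * (2 * (2 * 2 ^ K)))     ∎
  where
  open ≤-Reasoning
  six : ∀ n → 3 * suc (2 * n) + 3 ≡ 6 * suc n
  six = solve-∀
  sixteen : ∀ x → 6 * (2 * x) + 4 * x ≡ 2 * (2 * (2 * (2 * x)))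
  sixteen = solve-∀

^-distribʳ-* : ∀ x y k → (x * y) ^ k ≡ x ^ k * y ^ k
^-distribʳ-* x y zero    = refl
^-distribʳ-* x y (suc k) =
  trans (cong (x * y *_) (^-distribʳ-* x y k)) (interchange x y (x ^ k) (y ^ k))
  where
  interchange : ∀ x y u w → x * y * (u * w) ≡ x * u * (y * w)
  interchange = solve-∀

^-swap : ∀ x k l → (x ^ k) ^ l ≡ (x ^ l) ^ k
^-swap x k l = trans (^-*-assoc x k l) (trans (cong (x ^_) (*-comm k l)) (sym (^-*-assoc x l k)))

≤*3^K⇒LeTimesPowLog23 : ∀ {t c n K} → 2 ^ K ≤ n → t ≤ c * 3 ^ K → LeTimesPowLog23 t c n
≤*3^K⇒LeTimesPowLog23 {t} {c} {n} {K} 2^K≤n t≤ p q _ 3^q<2^p = begin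
  t ^ q               ≤⟨ ^-monoˡ-≤ q t≤ ⟩
  (c * 3 ^ K) ^ q     ≡⟨ ^-distribʳ-* c (3 ^ K) q ⟩
  c ^ q * (3 ^ K) ^ q ≤⟨ *-monoʳ-≤ (c ^ q) 3^Kq≤n^p ⟩
  c ^ q * n ^ p       ∎
  where
  open ≤-Reasoning
  3^Kq≤n^p : (3 ^ K) ^ q ≤ n ^ p
  3^Kq≤n^p = begin
    (3 ^ K) ^ q ≡⟨ ^-swap 3 K q ⟩
    (3 ^ q) ^ K ≤⟨ ^-monoˡ-≤ K (<⇒≤ 3^q<2^p) ⟩
    (2 ^ p) ^ K ≡⟨ ^-swap 2 p K ⟩
    (2 ^ K) ^ p ≤⟨ ^-monoˡ-≤ p 2^K≤n ⟩
    n ^ p       ∎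

eitherOne : (Fin m → Bool) → Fin m × Fin m → Bool
eitherOne x uv = x (proj₁ uv) ∨ x (proj₂ uv)

pairs : (m : ℕ) → List (Fin m × Fin m)
pairs m = cartesianProduct (allFin m) (allFin m)

length-pairs : (m : ℕ) → length (pairs m) ≡ m * m
length-pairs m = trans (length-cartesianProduct (allFin m) (allFin m))
                       (cong₂ _*_ (length-tabulate {n = m} id) (length-tabulate {n = m} id))

rejections-pairs : (x : Fin m → Bool) →
                   rejections (pairs m) (eitherOne x) 0 ≤ countOnes (not ∘ x) * countOnes (not ∘ x)
rejections-pairs {m} x = begin
  count (not ∘ evalTree (eitherOne x)) (map leaf (pairs m))
    ≡⟨ count-map (not ∘ evalTree (eitherOne x)) leaf (pairs m) ⟩
  count (not ∘ eitherOne x) (pairs m)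
    ≤⟨ count-mono (λ uv → Boolₚ.≤-reflexive (not-∨ (x (proj₁ uv)) (x (proj₂ uv)))) (pairs m) ⟩
  count (λ uv → not (x (proj₁ uv)) ∧ not (x (proj₂ uv))) (pairs m)
    ≡⟨ count-× (not ∘ x) (not ∘ x) (allFin m) (allFin m) ⟩
  count (not ∘ x) (allFin m) * count (not ∘ x) (allFin m)
    ≡⟨ cong₂ _*_ zeros zeros ⟩
  countOnes (not ∘ x) * countOnes (not ∘ x)
    ∎
  where
  open ≤-Reasoning
  zeros : count (not ∘ x) (allFin m) ≡ countOnes (not ∘ x)
  zeros = count-tabulate (not ∘ x) id

rejections-bound : ∀ n D {x : Fin (suc (2 * n)) → Bool} → MAJ n x ≡ true →
  let ts = trees (pairs (suc (2 * n))) D in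
  4 ^ 2 ^ D * 3 * rejections (pairs (suc (2 * n))) (eitherOne x) D ≤ 3 ^ 2 ^ D * length ts
rejections-bound n D {x} Mx = amplification (pairs 2n+1) (eitherOne x) base D
  where
  2n+1 z : ℕ
  2n+1 = suc (2 * n)
  z = countOnes (not ∘ x)
  2z≤2n+1 : 2 * z ≤ 2n+1
  2z≤2n+1 = m≤n⇒m≤1+n (*-monoʳ-≤ 2 (zeros≤n {n} {x} Mx))
  base : 4 * 3 * rejections (pairs 2n+1) (eitherOne x) 0 ≤ 3 * length (trees (pairs 2n+1) 0)
  base = begin
    4 * 3 * rejections (pairs 2n+1) (eitherOne x) 0 ≤⟨ *-monoʳ-≤ 12 (rejections-pairs x) ⟩
    4 * 3 * (z * z)                                 ≡⟨ double z ⟩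
    3 * (2 * z * (2 * z))                           ≤⟨ *-monoʳ-≤ 3 (*-mono-≤ 2z≤2n+1 2z≤2n+1) ⟩
    3 * (2n+1 * 2n+1)                               ≡⟨ cong (3 *_) length-leaves ⟨
    3 * length (trees (pairs 2n+1) 0)               ∎
    where
    open ≤-Reasoning
    double : ∀ z → 4 * 3 * (z * z) ≡ 3 * (2 * z * (2 * z))
    double = solve-∀
    length-leaves : length (trees (pairs 2n+1) 0) ≡ 2n+1 * 2n+1
    length-leaves = trans (length-map leaf (pairs 2n+1)) (length-pairs 2n+1)

misses : (n : ℕ) → (Fin (suc (2 * n)) → Bool) →
         Tree (Fin (suc (2 * n)) × Fin (suc (2 * n))) d → Bool
misses n x t = MAJ n x ∧ not (evalTree (eitherOne x) t)

misses≡false⇒accepts : {x : Fin (suc (2 * n)) → Bool} {t : Tree (Fin (suc (2 * n)) × Fin (suc (2 * n))) d} →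
                       MAJ n x ≡ true → misses n x t ≡ false → evalTree (eitherOne x) t ≡ true
misses≡false⇒accepts {x = x} {t} Mx missed =
  Boolₚ.not-injective (subst (λ b → b ∧ not (evalTree (eitherOne x) t) ≡ false) Mx missed)

few-misses : ∀ n D → 3 * suc (2 * n) ≤ 2 ^ D →
  let ts = trees (pairs (suc (2 * n))) D in
  sum (map (λ x → count (misses n x) ts) (inputs (suc (2 * n)))) < length ts
few-misses n D 3[2n+1]≤2^D = *-cancelˡ-< (4 ^ 2 ^ D * 3) _ _ (begin-strict
  4 ^ 2 ^ D * 3 * sum (map (λ x → count (misses n x) ts) (inputs 2n+1))
    ≤⟨ sum-map-≤ {k = 4 ^ 2 ^ D * 3} (λ x → count (misses n x) ts) misses-bound (inputs 2n+1) ⟩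
  length (inputs 2n+1) * (3 ^ 2 ^ D * length ts)
    ≡⟨ cong (_* (3 ^ 2 ^ D * length ts)) (length-inputs 2n+1) ⟩
  2 ^ 2n+1 * (3 ^ 2 ^ D * length ts)
    ≡⟨ *-assoc (2 ^ 2n+1) (3 ^ 2 ^ D) (length ts) ⟨
  2 ^ 2n+1 * 3 ^ 2 ^ D * length ts
    <⟨ *-monoˡ-< (length ts) (2^m*3^E<4^E*3 {2n+1} 3[2n+1]≤2^D) ⟩
  4 ^ 2 ^ D * 3 * length ts
    ∎)
  where
  open ≤-Reasoning
  2n+1 : ℕ
  2n+1 = suc (2 * n)
  ts : List (Tree (Fin 2n+1 × Fin 2n+1) D)
  ts = trees (pairs 2n+1) D
  instance
    ts≢[] : NonZero (length ts)
    ts≢[] = >-nonZero (length-trees-pos (pairs 2n+1) (subst (0 <_) (sym (length-pairs 2n+1)) (s≤s z≤n)) D)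
  misses-bound : ∀ x → 4 ^ 2 ^ D * 3 * count (misses n x) ts ≤ 3 ^ 2 ^ D * length ts
  misses-bound x = count-∧-bound {k = 4 ^ 2 ^ D * 3} (MAJ n x) ts (rejections-bound n D {x})

∃-accepting-tree : ∀ n D → 3 * suc (2 * n) ≤ 2 ^ D →
  ∃ λ (t : Tree (Fin (suc (2 * n)) × Fin (suc (2 * n))) D) →
    ∀ x → MAJ n x ≡ true → evalTree (eitherOne x) t ≡ true
∃-accepting-tree n D 3[2n+1]≤2^D = t , accepts
  where
  2n+1 : ℕ
  2n+1 = suc (2 * n)
  passing : ∃ λ (t : Tree (Fin 2n+1 × Fin 2n+1) D) → ∀ {x} → x ∈ inputs 2n+1 → misses n x t ≡ false
  passing =
    ∃-passing-all (misses n) (inputs 2n+1) (trees (pairs 2n+1) D) (few-misses n D 3[2n+1]≤2^D)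
  t : Tree (Fin 2n+1 × Fin 2n+1) D
  t = proj₁ passing
  accepts : ∀ x → MAJ n x ≡ true → evalTree (eitherOne x) t ≡ true
  accepts x Mx =
    let y , y∈ , y≗x = inputs-complete x
        My : MAJ n y ≡ true
        My = trans (MAJ-cong {n} y≗x) Mx
    in begin
      evalTree (eitherOne x) t
        ≡⟨ evalTree-cong (λ uv → cong₂ _∨_ (y≗x (proj₁ uv)) (y≗x (proj₂ uv))) t ⟨
      evalTree (eitherOne y) t
        ≡⟨ misses≡false⇒accepts {n} {x = y} {t} My (proj₂ passing y∈) ⟩
      true
        ∎
    where open ≡-Reasoning

maj3Formula-for-MAJ : ∀ n D → 3 * suc (2 * n) ≤ 2 ^ D →
  (f : MonFormula (suc (2 * n))) → (∀ x → evalMon f x ≡ MAJ n x) →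
  Σ (Maj3Formula (suc (2 * n))) λ g →
    sizeMaj3 g < 3 ^ D * (2 * sizeMon f) × (∀ x → evalMaj3 g x ≡ MAJ n x)
maj3Formula-for-MAJ n D 3[2n+1]≤2^D f f≗MAJ =
  graft leafFormula t , sizeMaj3-graft leafFormula leaf-size t , computes
  where
  t : Tree (Fin (suc (2 * n)) × Fin (suc (2 * n))) D
  t = proj₁ (∃-accepting-tree n D 3[2n+1]≤2^D)
  leafFormula : Fin (suc (2 * n)) × Fin (suc (2 * n)) → Maj3Formula (suc (2 * n))
  leafFormula uv = toMaj3 (proj₁ uv) (proj₂ uv) f
  leaf-size : ∀ uv → sizeMaj3 (leafFormula uv) < 2 * sizeMon f
  leaf-size uv = sizeMaj3-toMaj3 (proj₁ uv) (proj₂ uv) f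
  leaf-covers : ∀ {x} → MAJ n x ≡ true → ∀ uv → eitherOne x uv Bool.≤ evalMaj3 (leafFormula uv) x
  leaf-covers Mx uv = toMaj3-covers f f≗MAJ (MAJ-selfDual {n}) (proj₁ uv) (proj₂ uv) Mx
  computes : ∀ x → evalMaj3 (graft leafFormula t) x ≡ MAJ n x
  computes = selfDual-agree (MAJ-selfDual {n}) (evalMaj3-selfDual (graft leafFormula t)) λ x Mx →
    trans (evalMaj3-graft leafFormula t x)
          (≤-true⇒true (evalTree-mono (leaf-covers Mx) t) (proj₂ (∃-accepting-tree n D 3[2n+1]≤2^D) x Mx))

theorem2 : Σ ℕ λ c → 0 < c × ((n s : ℕ) → 1 ≤ n → 1 ≤ s →
    (Σ (MonFormula (suc (2 * n))) λ f → sizeMon f ≡ s × (∀ x → evalMon f x ≡ MAJ n x)) →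
    Σ (Maj3Formula (suc (2 * n))) λ g →
      LeTimesPowLog23 (sizeMaj3 g) (c * s) n × (∀ x → evalMaj3 g x ≡ MAJ n x))
theorem2 = 162 , s≤s z≤n , λ where
  n .(sizeMon f) 1≤n _ (f , refl , f≗MAJ) →
    let K , 2^K≤n , n<2^[1+K] = 2^K≤n<2^[1+K] 1≤n
        g , size<  , g≗MAJ    = maj3Formula-for-MAJ n (4 + K) (3[1+2n]≤2^[4+K] {n} {K} n<2^[1+K]) f f≗MAJ
        constant : ∀ s x → 3 * (3 * (3 * (3 * x))) * (2 * s) ≡ 162 * s * x
        constant = solve-∀
        size≤ : sizeMaj3 g ≤ 162 * sizeMon f * 3 ^ K
        size≤ = ≤-trans (<⇒≤ size<) (≤-reflexive (constant (sizeMon f) (3 ^ K)))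
    in g , ≤*3^K⇒LeTimesPowLog23 {K = K} 2^K≤n size≤ , g≗MAJ
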